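{- Let $L$ be a residuated lattice with $\mathrm{Rad}(L)=\{1\}$, and let $M_0(L)$ be the set of maximal filters of $L$ that are isolated points of $Max(L)$. Then $\mathrm{Soc}(L)$ is a principal filter of $L$ if and only if $M_0(L)$ is finite.
   Context: A residuated lattice is an algebra $(L,\wedge,\vee,\odot,\rightarrow,0,1)$ such that $(L,\wedge,\vee,0,1)$ is a bounded lattice, $(L,\odot,1)$ is a commutative monoid, and $x\odot z\le y$ iff $z\le x\rightarrow y$. A filter is a nonempty subset closed under $\odot$ and upward closed; it is principal if it equals $[a)$, the filter generated by a single element $a$. $Max(L)$ is the set of maximal filters, with topology whose open sets are $\{M\in Max(L)\mid A\not\subseteq M\}$ for $A\subseteq L$; $\mathrm{Rad}(L)=\bigcap Max(L)$. A filter $T$ is simple if $T\neq\{1\}$ and the only filters contained in $T$ are $\{1\}$ and $T$; $\mathrm{Soc}(L)$ is the smallest filter containing all simple filters if there is at least one, and $\{1\}$ otherwise. -}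

module Defs where

open import Level using (0ℓ)
open import Data.Nat using (ℕ)
open import Data.Fin using (Fin)
open import Data.Product using (Σ; ∃; _×_)
open import Data.Sum using (_⊎_)
open import Relation.Nullary using (¬_)
open import Relation.Unary using (Pred; _⊆_; _≐_; ｛_｝; _∈_)
open import Relation.Binary.PropositionalEquality using (_≡_)
open import Algebra.Core using (Op₂)
open import Algebra.Structures using (IsCommutativeMonoid)
open import Algebra.Lattice.Structures using (IsLattice)

record ResiduatedLattice : Set₁ where
  infixr 7 _⊙_
  infixr 6 _∧_
  infixr 5 _∨_
  infixr 4 _⇒_
  infix 3 _≤_
  field
    Carrier : Set
    _∧_ _∨_ _⊙_ _⇒_ : Op₂ Carrier
    0# 1# : Carrier
    isLattice : IsLattice _≡_ _∨_ _∧_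
  _≤_ : Carrier → Carrier → Set
  x ≤ y = x ∧ y ≡ x
  field
    0-least : ∀ x → 0# ≤ x
    1-greatest : ∀ x → x ≤ 1#
    ⊙-isCommutativeMonoid : IsCommutativeMonoid _≡_ _⊙_ 1#
    residuation : ∀ x y z → (x ⊙ z ≤ y → z ≤ x ⇒ y) × (z ≤ x ⇒ y → x ⊙ z ≤ y)

module _ (L : ResiduatedLattice) where
  open ResiduatedLattice L

  record IsFilter (F : Pred Carrier 0ℓ) : Set where
    field
      nonempty : ∃ λ x → F x
      ⊙-closed : ∀ {x y} → F x → F y → F (x ⊙ y)
      up-closed : ∀ {x y} → F x → x ≤ y → F y

  Generated : Pred Carrier 0ℓ → Pred Carrier (Level.suc 0ℓ)
  Generated S x = ∀ (F : Pred Carrier 0ℓ) → IsFilter F → S ⊆ F → F x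

  principalFilter : Carrier → Pred Carrier (Level.suc 0ℓ)
  principalFilter a = Generated ｛ a ｝

  IsPrincipal : Pred Carrier (Level.suc 0ℓ) → Set₁
  IsPrincipal F = ∃ λ a → F ≐ principalFilter a

  IsProper : Pred Carrier 0ℓ → Set
  IsProper F = ¬ (∀ x → F x)

  IsMaximal : Pred Carrier 0ℓ → Set₁
  IsMaximal M = IsFilter M × IsProper M ×
    (∀ (G : Pred Carrier 0ℓ) → IsFilter G → M ⊆ G → IsProper G → G ⊆ M)

  Rad : Pred Carrier (Level.suc 0ℓ)
  Rad x = ∀ (M : Pred Carrier 0ℓ) → IsMaximal M → M x

  -- the basic open set of Max(L) determined by A ⊆ L: { M ∈ Max(L) | A ⊄ M }
  -- M is an isolated point of Max(L): {M} is open, i.e. {M} = {N ∈ Max(L) | A ⊄ N} for some A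
  IsIsolated : Pred Carrier 0ℓ → Set₁
  IsIsolated M = ∃ λ (A : Pred Carrier 0ℓ) →
    ∀ (N : Pred Carrier 0ℓ) → IsMaximal N → (¬ (A ⊆ N) → N ≐ M) × (N ≐ M → ¬ (A ⊆ N))

  InM₀ : Pred Carrier 0ℓ → Set₁
  InM₀ M = IsMaximal M × IsIsolated M

  M₀-Finite : Set₁
  M₀-Finite = Σ ℕ λ n → Σ (Fin n → Pred Carrier 0ℓ) λ f →
    ∀ (M : Pred Carrier 0ℓ) → InM₀ M → ∃ λ i → M ≐ f i

  IsSimple : Pred Carrier 0ℓ → Set₁
  IsSimple T = IsFilter T × ¬ (T ≐ ｛ 1# ｝) ×
    (∀ (G : Pred Carrier 0ℓ) → IsFilter G → G ⊆ T → (G ≐ ｛ 1# ｝) ⊎ (G ≐ T))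

  -- Soc(L): smallest filter containing all simple filters
  -- (this is {1} when there are no simple filters, as {1} is a filter)
  Soc : Pred Carrier (Level.suc 0ℓ)
  Soc x = ∀ (F : Pred Carrier 0ℓ) → IsFilter F →
    (∀ (T : Pred Carrier 0ℓ) → IsSimple T → T ⊆ F) → F x

-- excluded middle (the paper works in classical mathematics)
ExcludedMiddle : Set₂
ExcludedMiddle = ∀ (P : Set₁) → P ⊎ ¬ P

{-# OPTIONS --safe #-}
-- With Rad L = {1}, a maximal filter M is an isolated point of Max(L) exactly when some a ∉ M
-- lies in every other maximal filter, and then [a) is a simple filter.  Conversely a simple
-- filter T ≠ {1} is contained in every maximal filter but exactly one, which is therefore
-- isolated.  So if M₀(L) is finite, the product of one such a per isolated point generates
-- Soc L; and a generator s of Soc L lies in all but finitely many maximal filters (being a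
-- product of elements of simple filters) but in no isolated one.
module Submission where

open import Defs
open import Level using (Lift; lift; 0ℓ)
open import Data.Empty using (⊥; ⊥-elim)
open import Data.Fin using (Fin; zero; suc; _↑ˡ_; _↑ʳ_)
open import Data.Nat using (ℕ; zero; suc; _+_)
open import Data.Product using (Σ; ∃; _×_; _,_; proj₁; proj₂)
open import Data.Sum using (_⊎_; inj₁; inj₂)
open import Data.Unit using (⊤; tt)
open import Data.Vec.Functional using (Vector; _++_)
open import Data.Vec.Functional.Properties using (lookup-++ˡ; lookup-++ʳ)
open import Relation.Nullary using (¬_)
open import Relation.Unary using (Pred; _⊆_; _⊈_; _≐_; ｛_｝; _∩_; _∪_)
open import Relation.Unary.Properties using (≐-refl)
open import Relation.Binary.PropositionalEquality using (_≡_; refl; sym; trans; cong; subst; subst₂)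
open import Algebra.Bundles using (CommutativeMonoid)
open import Algebra.Lattice.Bundles using (Lattice)
import Algebra.Lattice.Properties.Lattice as LatticeProperties
import Algebra.Properties.Monoid.Mult as MonoidMult
import Algebra.Properties.CommutativeSemigroup as CommutativeSemigroupProperties
import Algebra.Definitions.RawMonoid as RawMonoidDefinitions
import Relation.Binary.Lattice as OrderLattice

-- M₀-Finite L is FinitelyCovered (InM₀ L).
FinitelyCovered : {X : Set} → Pred (Pred X 0ℓ) (Level.suc 0ℓ) → Set₁
FinitelyCovered {X} P = Σ ℕ λ n → Σ (Fin n → Pred X 0ℓ) λ f → ∀ M → P M → ∃ λ i → M ≐ f i

module _ {X : Set} {P Q : Pred (Pred X 0ℓ) (Level.suc 0ℓ)} where

  covered-⊆ : Q ⊆ P → FinitelyCovered P → FinitelyCovered Q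
  covered-⊆ Q⊆P (n , f , cover) = n , f , λ M QM → cover M (Q⊆P QM)

  covered-∪ : FinitelyCovered P → FinitelyCovered Q → FinitelyCovered (P ∪ Q)
  covered-∪ (m , f , coverP) (n , g , coverQ) = m + n , f ++ g , cover
    where
      cover : ∀ M → (P ∪ Q) M → ∃ λ i → M ≐ (f ++ g) i
      cover M (inj₁ PM) with coverP M PM
      ... | i , M≐fi = i ↑ˡ n , subst (M ≐_) (sym (lookup-++ˡ f g i)) M≐fi
      cover M (inj₂ QM) with coverQ M QM
      ... | i , M≐gi = m ↑ʳ i , subst (M ≐_) (sym (lookup-++ʳ f g i)) M≐gi

covered-∅ : {X : Set} {P : Pred (Pred X 0ℓ) (Level.suc 0ℓ)} → (∀ M → ¬ P M) → FinitelyCovered P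
covered-∅ ¬P = 0 , (λ ()) , λ M PM → ⊥-elim (¬P M PM)

module Classical (em : ExcludedMiddle) where

  em₀ : (P : Set) → P ⊎ ¬ P
  em₀ P with em (Lift _ P)
  ... | inj₁ (lift p) = inj₁ p
  ... | inj₂ ¬p = inj₂ (λ p → ¬p (lift p))

  dne₀ : {P : Set} → ¬ ¬ P → P
  dne₀ {P} ¬¬p with em₀ P
  ... | inj₁ p = p
  ... | inj₂ ¬p = ⊥-elim (¬¬p ¬p)

  dne₁ : {P : Set₁} → ¬ ¬ P → P
  dne₁ {P} ¬¬p with em P
  ... | inj₁ p = p
  ... | inj₂ ¬p = ⊥-elim (¬¬p ¬p)

  ⊈⇒∃ : {X : Set} {P Q : Pred X 0ℓ} → P ⊈ Q → ∃ λ x → P x × ¬ Q x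
  ⊈⇒∃ P⊈Q = dne₀ λ ¬∃ → P⊈Q λ {x} Px → dne₀ λ ¬Qx → ¬∃ (x , Px , ¬Qx)

  ¬×⇒¬⊎¬ : {P Q : Set} → ¬ (P × Q) → ¬ P ⊎ ¬ Q
  ¬×⇒¬⊎¬ {P} ¬pq with em₀ P
  ... | inj₁ p = inj₂ λ q → ¬pq (p , q)
  ... | inj₂ ¬p = inj₁ ¬p

  -- Propositional resizing, a consequence of excluded middle.
  Resize : Set₁ → Set
  Resize P with em P
  ... | inj₁ _ = ⊤
  ... | inj₂ _ = ⊥

  resize : {P : Set₁} → P → Resize P
  resize {P} p with em P
  ... | inj₁ _ = tt
  ... | inj₂ ¬p = ¬p p

  unresize : {P : Set₁} → Resize P → P
  unresize {P} r with em P
  unresize {P} tt | inj₁ p = p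

  module _ {X : Set} (P : X → Set₁) (default : X) where

    ε : X
    ε with em (∃ P)
    ... | inj₁ (x , _) = x
    ... | inj₂ _ = default

    ε-spec : ∃ P → P ε
    ε-spec ∃P with em (∃ P)
    ... | inj₁ (_ , Px) = Px
    ... | inj₂ ¬∃P = ⊥-elim (¬∃P ∃P)

    ε-elim : ∀ {ℓ} (Q : Pred X ℓ) → (∀ {x} → P x → Q x) → Q default → Q ε
    ε-elim Q P⊆Q Qdefault with em (∃ P)
    ... | inj₁ (_ , Px) = P⊆Q Px
    ... | inj₂ _ = Qdefault

  covered-subsingleton : {X : Set} {P : Pred (Pred X 0ℓ) (Level.suc 0ℓ)} →
                         (∀ {M N} → P M → P N → M ≐ N) → FinitelyCovered P
  covered-subsingleton {P = P} unique with em (∃ P)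
  ... | inj₁ (M , PM) = 1 , (λ _ → M) , λ N PN → zero , unique PN PM
  ... | inj₂ ¬∃P = covered-∅ λ M PM → ¬∃P (M , PM)

module ResiduatedLatticeProperties (L : ResiduatedLattice) where
  open ResiduatedLattice L
  private
    lattice : Lattice 0ℓ 0ℓ
    lattice = record { isLattice = isLattice }

    ⊙-commutativeMonoid : CommutativeMonoid 0ℓ 0ℓ
    ⊙-commutativeMonoid = record { isCommutativeMonoid = ⊙-isCommutativeMonoid }

  open CommutativeMonoid ⊙-commutativeMonoid using (monoid; rawMonoid; commutativeSemigroup)
    renaming (comm to ⊙-comm; identityʳ to ⊙-identityʳ)
  open CommutativeSemigroupProperties commutativeSemigroup using (interchange)
  open MonoidMult monoid using (×-homo-+) renaming (_×_ to _×⊙_)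
  open RawMonoidDefinitions rawMonoid public using () renaming (sum to ∏)

  -- The standard library orders a lattice by x ≡ x ∧ y, the symmetric form of our x ∧ y ≡ x.
  private
    module Order = OrderLattice.Lattice (LatticeProperties.∨-∧-orderTheoreticLattice lattice)

  ≤-reflexive : ∀ {x y} → x ≡ y → x ≤ y
  ≤-reflexive x≡y = sym (Order.reflexive x≡y)

  ≤-trans : ∀ {x y z} → x ≤ y → y ≤ z → x ≤ z
  ≤-trans x≤y y≤z = sym (Order.trans (sym x≤y) (sym y≤z))

  x≤x∨y : ∀ x y → x ≤ x ∨ y
  x≤x∨y x y = sym (Order.x≤x∨y x y)

  y≤x∨y : ∀ x y → y ≤ x ∨ y
  y≤x∨y x y = sym (Order.y≤x∨y x y)

  ∨-least : ∀ {x y z} → x ≤ z → y ≤ z → x ∨ y ≤ z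
  ∨-least x≤z y≤z = sym (Order.∨-least (sym x≤z) (sym y≤z))

  curry : ∀ {x y z} → x ⊙ z ≤ y → z ≤ x ⇒ y
  curry = proj₁ (residuation _ _ _)

  uncurry : ∀ {x y z} → z ≤ x ⇒ y → x ⊙ z ≤ y
  uncurry = proj₂ (residuation _ _ _)

  ⊙-monoˡ : ∀ {x y} z → x ≤ y → x ⊙ z ≤ y ⊙ z
  ⊙-monoˡ {x} {y} z x≤y =
    subst (_≤ y ⊙ z) (⊙-comm z x) (uncurry (≤-trans x≤y (curry (≤-reflexive (⊙-comm z y)))))

  ⊙-monoʳ : ∀ {x y} z → x ≤ y → z ⊙ x ≤ z ⊙ y
  ⊙-monoʳ {x} {y} z x≤y = subst₂ _≤_ (⊙-comm x z) (⊙-comm y z) (⊙-monoˡ z x≤y)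

  ⊙-mono : ∀ {x y u v} → x ≤ y → u ≤ v → x ⊙ u ≤ y ⊙ v
  ⊙-mono {y = y} {u} x≤y u≤v = ≤-trans (⊙-monoˡ u x≤y) (⊙-monoʳ y u≤v)

  x⊙y≤x : ∀ x y → x ⊙ y ≤ x
  x⊙y≤x x y = subst (x ⊙ y ≤_) (⊙-identityʳ x) (⊙-monoʳ x (1-greatest y))

  x⊙y≤y : ∀ x y → x ⊙ y ≤ y
  x⊙y≤y x y = subst (_≤ y) (⊙-comm y x) (x⊙y≤x y x)

  ⊙-∨-least : ∀ {x y z u} → x ⊙ y ≤ u → x ⊙ z ≤ u → x ⊙ (y ∨ z) ≤ u
  ⊙-∨-least xy≤u xz≤u = uncurry (∨-least (curry xy≤u) (curry xz≤u))

  ∨≡1⇒⊙≤⇒≤ : ∀ {a b c} → a ∨ b ≡ 1# → c ⊙ b ≤ a → c ≤ a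
  ∨≡1⇒⊙≤⇒≤ {a} {b} {c} a∨b≡1 cb≤a =
    subst (_≤ a) (trans (cong (c ⊙_) a∨b≡1) (⊙-identityʳ c)) (⊙-∨-least (x⊙y≤y c a) cb≤a)

  _^_ : Carrier → ℕ → Carrier
  x ^ n = n ×⊙ x

  ^-mono : ∀ {x y} → x ≤ y → ∀ n → x ^ n ≤ y ^ n
  ^-mono x≤y zero = ≤-reflexive refl
  ^-mono x≤y (suc n) = ⊙-mono x≤y (^-mono x≤y n)

  ∏-≤ : ∀ {n} (xs : Vector Carrier n) i → ∏ xs ≤ xs i
  ∏-≤ {suc n} xs zero = x⊙y≤x (xs zero) _
  ∏-≤ {suc n} xs (suc i) = ≤-trans (x⊙y≤y (xs zero) _) (∏-≤ (λ j → xs (suc j)) i)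

  module _ {F : Pred Carrier 0ℓ} (isF : IsFilter L F) where
    open IsFilter isF

    filter-1 : F 1#
    filter-1 = up-closed (proj₂ nonempty) (1-greatest _)

    filter-^ : ∀ {x} → F x → ∀ n → F (x ^ n)
    filter-^ Fx zero = filter-1
    filter-^ Fx (suc n) = ⊙-closed Fx (filter-^ Fx n)

    filter-∏ : ∀ {n} (xs : Vector Carrier n) → (∀ i → F (xs i)) → F (∏ xs)
    filter-∏ {zero} xs Fxs = filter-1
    filter-∏ {suc n} xs Fxs = ⊙-closed (Fxs zero) (filter-∏ (λ i → xs (suc i)) (λ i → Fxs (suc i)))

    principalFilter-least : ∀ {a} → F a → principalFilter L a ⊆ F
    principalFilter-least Fa x∈⟨a⟩ = x∈⟨a⟩ F isF λ { refl → Fa }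

  filter-⊆1⇒≐1 : ∀ {F} → IsFilter L F → F ⊆ ｛ 1# ｝ → F ≐ ｛ 1# ｝
  filter-⊆1⇒≐1 isF F⊆1 = F⊆1 , λ { refl → filter-1 isF }

  ∩-isFilter : ∀ {F G} → IsFilter L F → IsFilter L G → IsFilter L (F ∩ G)
  ∩-isFilter isF isG = record
    { nonempty = 1# , filter-1 isF , filter-1 isG
    ; ⊙-closed = λ (Fx , Gx) (Fy , Gy) → F.⊙-closed Fx Fy , G.⊙-closed Gx Gy
    ; up-closed = λ (Fx , Gx) x≤y → F.up-closed Fx x≤y , G.up-closed Gx x≤y
    }
    where
      module F = IsFilter isF
      module G = IsFilter isG

  ↑ : Carrier → Pred Carrier 0ℓ
  ↑ a x = ∃ λ n → a ^ n ≤ x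

  ↑-isFilter : ∀ a → IsFilter L (↑ a)
  ↑-isFilter a = record
    { nonempty = 1# , 0 , 1-greatest 1#
    ; ⊙-closed = λ (m , aᵐ≤x) (n , aⁿ≤y) →
        m + n , subst (_≤ _) (sym (×-homo-+ a m n)) (⊙-mono aᵐ≤x aⁿ≤y)
    ; up-closed = λ (n , aⁿ≤x) x≤y → n , ≤-trans aⁿ≤x x≤y
    }

  a∈↑a : ∀ a → ↑ a a
  a∈↑a a = 1 , x⊙y≤x a 1#

  ↑-least : ∀ {F a} → IsFilter L F → F a → ↑ a ⊆ F
  ↑-least isF Fa (n , aⁿ≤x) = IsFilter.up-closed isF (filter-^ isF Fa n) aⁿ≤x

  ↑-antitone : ∀ {a b} → a ≤ b → ↑ b ⊆ ↑ a
  ↑-antitone a≤b (n , bⁿ≤x) = n , ≤-trans (^-mono a≤b n) bⁿ≤x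

  ↑⊆principalFilter : ∀ {a} → ↑ a ⊆ principalFilter L a
  ↑⊆principalFilter x∈↑a F isF a∈F = ↑-least isF (a∈F refl) x∈↑a

  -- The filter generated by F ∪ {g}.
  _∨↑_ : Pred Carrier 0ℓ → Carrier → Pred Carrier 0ℓ
  (F ∨↑ g) x = ∃ λ n → ∃ λ m → F m × g ^ n ⊙ m ≤ x

  ∨↑-isFilter : ∀ {F} g → IsFilter L F → IsFilter L (F ∨↑ g)
  ∨↑-isFilter g isF = record
    { nonempty = 1# , 0 , 1# , filter-1 isF , 1-greatest _
    ; ⊙-closed = λ (n₁ , m₁ , Fm₁ , ≤x) (n₂ , m₂ , Fm₂ , ≤y) →
        n₁ + n₂ , m₁ ⊙ m₂ , IsFilter.⊙-closed isF Fm₁ Fm₂ ,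
        ≤-trans (≤-reflexive (regroup n₁ n₂ m₁ m₂)) (⊙-mono ≤x ≤y)
    ; up-closed = λ (n , m , Fm , ≤x) x≤y → n , m , Fm , ≤-trans ≤x x≤y
    }
    where
      regroup : ∀ n₁ n₂ m₁ m₂ → g ^ (n₁ + n₂) ⊙ (m₁ ⊙ m₂) ≡ (g ^ n₁ ⊙ m₁) ⊙ (g ^ n₂ ⊙ m₂)
      regroup n₁ n₂ m₁ m₂ =
        trans (cong (_⊙ (m₁ ⊙ m₂)) (×-homo-+ g n₁ n₂)) (interchange (g ^ n₁) (g ^ n₂) m₁ m₂)

  F⊆F∨↑g : ∀ {F} g → F ⊆ F ∨↑ g
  F⊆F∨↑g g {x} Fx = 0 , x , Fx , x⊙y≤y 1# x

  g∈F∨↑g : ∀ {F} g → IsFilter L F → (F ∨↑ g) g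
  g∈F∨↑g g isF = 1 , 1# , filter-1 isF , ≤-trans (x⊙y≤x (g ^ 1) 1#) (x⊙y≤x g 1#)

  simple⊆Soc : ∀ {T} → IsSimple L T → T ⊆ Soc L
  simple⊆Soc {T} simpleT Tx F isF simples⊆F = simples⊆F T simpleT Tx

module MaximalFilters (em : ExcludedMiddle) (L : ResiduatedLattice) where
  open ResiduatedLattice L
  open ResiduatedLatticeProperties L
  open Classical em

  maximal-escape : ∀ {M g} → IsMaximal L M → ¬ M g → ∃ λ n → ∃ λ m → M m × g ^ n ⊙ m ≤ 0#
  maximal-escape {M} {g} (isM , _ , maximal) g∉M = dne₀ λ 0∉M∨↑g →
    g∉M (maximal (M ∨↑ g) (∨↑-isFilter g isM) (F⊆F∨↑g g) (λ all → 0∉M∨↑g (all 0#)) (g∈F∨↑g g isM))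

  simple-∩ : ∀ {T F} → IsSimple L T → IsFilter L F → T ⊈ F → T ∩ F ⊆ ｛ 1# ｝
  simple-∩ {T} {F} (isT , _ , minimal) isF T⊈F with minimal (T ∩ F) (∩-isFilter isT isF) proj₁
  ... | inj₁ T∩F≐1 = proj₁ T∩F≐1
  ... | inj₂ T∩F≐T = ⊥-elim (T⊈F λ Tt → proj₂ (proj₂ T∩F≐T Tt))

  -- Escaping N with x ∈ M ∖ N gives m ∈ N with xᵏ ⊙ m ≤ 0, and for t ∈ T the element
  -- t ∨ m lies in T ∩ N = {1}; so xᵏ = xᵏ ⊙ (t ∨ m) ≤ t.
  simple-⊆-filter : ∀ {T N M} → IsSimple L T → IsMaximal L N → T ⊈ N →
                    IsFilter L M → M ⊈ N → T ⊆ M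
  simple-⊆-filter simpleT maxN T⊈N isM M⊈N {t} Tt with ⊈⇒∃ M⊈N
  ... | x , Mx , x∉N with maximal-escape maxN x∉N
  ... | k , m , Nm , xᵏ⊙m≤0 = IsFilter.up-closed isM (filter-^ isM Mx k) xᵏ≤t
    where
      t∨m≡1 : t ∨ m ≡ 1#
      t∨m≡1 = sym (simple-∩ simpleT (proj₁ maxN) T⊈N
        ( IsFilter.up-closed (proj₁ simpleT) Tt (x≤x∨y t m)
        , IsFilter.up-closed (proj₁ maxN) Nm (y≤x∨y t m)))

      xᵏ≤t : x ^ k ≤ t
      xᵏ≤t = ∨≡1⇒⊙≤⇒≤ t∨m≡1 (≤-trans xᵏ⊙m≤0 (0-least t))

  simple-⊈-maximal-unique : ∀ {T M N} → IsSimple L T → IsMaximal L M → IsMaximal L N →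
                            T ⊈ M → T ⊈ N → M ≐ N
  simple-⊈-maximal-unique {T} simpleT maxM maxN T⊈M T⊈N =
    ⊆-from maxM T⊈M maxN T⊈N , ⊆-from maxN T⊈N maxM T⊈M
    where
      ⊆-from : ∀ {M N} → IsMaximal L M → T ⊈ M → IsMaximal L N → T ⊈ N → M ⊆ N
      ⊆-from {M} {N} maxM T⊈M maxN T⊈N {x} =
        dne₀ {M ⊆ N} (λ M⊈N → T⊈M (simple-⊆-filter simpleT maxN T⊈N (proj₁ maxM) M⊈N))

  Isolates : Carrier → Pred Carrier 0ℓ → Set₁
  Isolates a M = ¬ M a × (∀ N → IsMaximal L N → ¬ N ≐ M → N a)

  isolated⇒isolator : ∀ {M} → IsMaximal L M → IsIsolated L M → ∃ λ a → Isolates a M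
  isolated⇒isolator {M} maxM (A , isolates) with ⊈⇒∃ (proj₂ (isolates M maxM) ≐-refl)
  ... | a , Aa , a∉M = a , a∉M , λ N maxN N≉M →
    dne₀ λ a∉N → N≉M (proj₁ (isolates N maxN) (λ A⊆N → a∉N (A⊆N Aa)))

  isolator⇒isolated : ∀ {a M} → Isolates a M → IsIsolated L M
  isolator⇒isolated {a} (a∉M , others) = ｛ a ｝ , λ N maxN →
    (λ a∉N → dne₀ λ N≉M → a∉N λ { refl → others N maxN N≉M }) ,
    (λ N≐M a∈N → a∉M (proj₁ N≐M (a∈N refl)))

  simple-isolates : ∀ {T M t} → IsSimple L T → IsMaximal L M → T t → ¬ M t → Isolates t M
  simple-isolates simpleT maxM Tt t∉M = t∉M , λ N maxN N≉M → dne₀ λ t∉N →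
    N≉M (simple-⊈-maximal-unique simpleT maxN maxM (λ T⊆N → t∉N (T⊆N Tt)) (λ T⊆M → t∉M (T⊆M Tt)))

  InAllButFinitelyMany : Carrier → Set₁
  InAllButFinitelyMany x = FinitelyCovered λ M → IsMaximal L M × ¬ M x

  -- Resized, since the filters quantified over in Soc L are Set-valued.
  InAllButFinitelyMany-isFilter : IsFilter L (λ x → Resize (InAllButFinitelyMany x))
  InAllButFinitelyMany-isFilter = record
    { nonempty = 1# , resize (covered-∅ λ M (maxM , 1∉M) → 1∉M (filter-1 (proj₁ maxM)))
    ; ⊙-closed = λ x∈A y∈A → resize (covered-⊆ split (covered-∪ (unresize x∈A) (unresize y∈A)))
    ; up-closed = λ x∈A x≤y → resize (covered-⊆ (λ (maxM , y∉M) →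
        maxM , λ Mx → y∉M (IsFilter.up-closed (proj₁ maxM) Mx x≤y)) (unresize x∈A))
    }
    where
      split : ∀ {x y M} → IsMaximal L M × ¬ M (x ⊙ y) →
              (IsMaximal L M × ¬ M x) ⊎ (IsMaximal L M × ¬ M y)
      split (maxM , x⊙y∉M) with ¬×⇒¬⊎¬ (λ (Mx , My) → x⊙y∉M (IsFilter.⊙-closed (proj₁ maxM) Mx My))
      ... | inj₁ x∉M = inj₁ (maxM , x∉M)
      ... | inj₂ y∉M = inj₂ (maxM , y∉M)

  simple⊆InAllButFinitelyMany : ∀ {T} → IsSimple L T → T ⊆ λ x → Resize (InAllButFinitelyMany x)
  simple⊆InAllButFinitelyMany simpleT Tt = resize (covered-subsingleton λ (maxM , t∉M) (maxN , t∉N) →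
    simple-⊈-maximal-unique simpleT maxM maxN (λ T⊆M → t∉M (T⊆M Tt)) (λ T⊆N → t∉N (T⊆N Tt)))

module SemisimpleCase (em : ExcludedMiddle) (L : ResiduatedLattice)
                      (rad : Rad L ≐ ｛ ResiduatedLattice.1# L ｝) where
  open ResiduatedLattice L
  open ResiduatedLatticeProperties L
  open Classical em
  open MaximalFilters em L

  outside-some-maximal : ∀ {t} → ¬ 1# ≡ t → ∃ λ M → IsMaximal L M × ¬ M t
  outside-some-maximal t≢1 =
    dne₁ λ ∄M → t≢1 (proj₁ rad λ M maxM → dne₀ λ t∉M → ∄M (M , maxM , t∉M))

  isolator-∩ : ∀ {a M} → Isolates a M → M ∩ ↑ a ⊆ ｛ 1# ｝
  isolator-∩ {M = M} (_ , others) {x} (Mx , x∈↑a) = proj₁ rad λ N maxN → x∈N N maxN (em₀ (N ≐ M))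
    where
      x∈N : ∀ N → IsMaximal L N → N ≐ M ⊎ ¬ N ≐ M → N x
      x∈N N maxN (inj₁ N≐M) = proj₂ N≐M Mx
      x∈N N maxN (inj₂ N≉M) = ↑-least (proj₁ maxN) (others N maxN N≉M) x∈↑a

  isolator∈↑ : ∀ {a b M} → IsMaximal L M → Isolates a M → ¬ M b → ↑ b a
  isolator∈↑ {a} maxM isolates b∉M with maximal-escape maxM b∉M
  ... | n , m , Mm , bⁿ⊙m≤0 = n , ∨≡1⇒⊙≤⇒≤ a∨m≡1 (≤-trans bⁿ⊙m≤0 (0-least a))
    where
      a∨m≡1 : a ∨ m ≡ 1#
      a∨m≡1 = sym (isolator-∩ isolates
        ( IsFilter.up-closed (proj₁ maxM) Mm (y≤x∨y a m)
        , IsFilter.up-closed (↑-isFilter a) (a∈↑a a) (x≤x∨y a m)))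

  ↑-isolator-simple : ∀ {a M} → IsMaximal L M → Isolates a M → IsSimple L (↑ a)
  ↑-isolator-simple {a} {M} maxM isolates@(a∉M , _) = ↑-isFilter a , ↑a≉1 , minimal
    where
      ↑a≉1 : ¬ ↑ a ≐ ｛ 1# ｝
      ↑a≉1 ↑a≐1 = a∉M (subst M (proj₁ ↑a≐1 (a∈↑a a)) (filter-1 (proj₁ maxM)))

      -- A filter G ⊆ ↑ a inside M lies in M ∩ ↑ a = {1}; otherwise some g ∈ G escapes M,
      -- and a ∈ ↑ g ⊆ G.
      minimal : ∀ G → IsFilter L G → G ⊆ ↑ a → G ≐ ｛ 1# ｝ ⊎ G ≐ ↑ a
      minimal G isG G⊆↑a with em₀ (G ⊆ M)
      ... | inj₁ G⊆M = inj₁ (filter-⊆1⇒≐1 isG λ Gx → isolator-∩ isolates (G⊆M Gx , G⊆↑a Gx))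
      ... | inj₂ G⊈M with ⊈⇒∃ G⊈M
      ...   | g , Gg , g∉M = inj₂ (G⊆↑a , ↑-least isG (↑-least isG Gg (isolator∈↑ maxM isolates g∉M)))

  finite⇒Soc-principal : M₀-Finite L → IsPrincipal L (Soc L)
  finite⇒Soc-principal (n , f , cover) = ∏ b , Soc⊆⟨∏b⟩ , ⟨∏b⟩⊆Soc
    where
      b : Vector Carrier n
      b i = ε (λ x → Soc L x × ¬ f i x) 1#

      b∈Soc : ∀ i → Soc L (b i)
      b∈Soc i = ε-elim _ 1# (Soc L) proj₁ λ F isF _ → filter-1 isF

      isolator-above-∏b : ∀ {t M} → Soc L t → IsMaximal L M → Isolates t M → ↑ (∏ b) t
      isolator-above-∏b {t} {M} t∈Soc maxM t-isolates@(t∉M , _)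
        with cover M (maxM , isolator⇒isolated t-isolates)
      ... | i , M≐fᵢ = ↑-antitone (∏-≤ b i) (isolator∈↑ maxM t-isolates bᵢ∉M)
        where
          bᵢ-spec : Soc L (b i) × ¬ f i (b i)
          bᵢ-spec = ε-spec _ 1# (t , t∈Soc , λ fᵢt → t∉M (proj₂ M≐fᵢ fᵢt))

          bᵢ∉M : ¬ M (b i)
          bᵢ∉M M-bᵢ = proj₂ bᵢ-spec (proj₁ M≐fᵢ M-bᵢ)

      simple⊆↑∏b : ∀ T → IsSimple L T → T ⊆ ↑ (∏ b)
      simple⊆↑∏b T simpleT {t} Tt with em₀ (1# ≡ t)
      ... | inj₁ 1≡t = 0 , ≤-reflexive 1≡t
      ... | inj₂ t≢1 with outside-some-maximal t≢1
      ...   | M , maxM , t∉M =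
        isolator-above-∏b (simple⊆Soc simpleT Tt) maxM (simple-isolates simpleT maxM Tt t∉M)

      Soc⊆⟨∏b⟩ : Soc L ⊆ principalFilter L (∏ b)
      Soc⊆⟨∏b⟩ x∈Soc = ↑⊆principalFilter (x∈Soc (↑ (∏ b)) (↑-isFilter (∏ b)) simple⊆↑∏b)

      ⟨∏b⟩⊆Soc : principalFilter L (∏ b) ⊆ Soc L
      ⟨∏b⟩⊆Soc x∈⟨∏b⟩ F isF simples⊆F =
        principalFilter-least isF (filter-∏ isF b λ i → b∈Soc i F isF simples⊆F) x∈⟨∏b⟩

  -- s ∈ Soc L lies in all but finitely many maximal filters, but in no isolated one M:
  -- an isolator a of M generates a simple filter, so a ∈ Soc L = [s).
  Soc-principal⇒finite : IsPrincipal L (Soc L) → M₀-Finite L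
  Soc-principal⇒finite (s , Soc≐⟨s⟩) =
    covered-⊆ s∉M₀ (unresize (s∈Soc _ InAllButFinitelyMany-isFilter λ _ → simple⊆InAllButFinitelyMany))
    where
      s∈Soc : Soc L s
      s∈Soc = proj₂ Soc≐⟨s⟩ λ F isF s∈F → s∈F refl

      s∉M₀ : ∀ {M} → InM₀ L M → IsMaximal L M × ¬ M s
      s∉M₀ (maxM , isolatedM) with isolated⇒isolator maxM isolatedM
      ... | a , a-isolates@(a∉M , _) = maxM , λ Ms →
        a∉M (principalFilter-least (proj₁ maxM) Ms (proj₁ Soc≐⟨s⟩ a∈Soc))
        where
          a∈Soc : Soc L a
          a∈Soc = simple⊆Soc (↑-isolator-simple maxM a-isolates) (a∈↑a a)

theorem4p9 : ExcludedMiddle → (L : ResiduatedLattice) →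
    Rad L ≐ ｛ ResiduatedLattice.1# L ｝ →
      (IsPrincipal L (Soc L) → M₀-Finite L) × (M₀-Finite L → IsPrincipal L (Soc L))
theorem4p9 em L rad = Soc-principal⇒finite , finite⇒Soc-principal
  where open SemisimpleCase em L rad
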